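{- Let $Y$ be a set with $N$ elements, let $s$ be a positive integer, and let $\mathcal S$ be a family of $s$-element subsets of $Y$. Let $k<N/4$ be an integer, $T>1$, and $m$ an integer. Then for all but at most $T^{ -k/s}\binom{N}{m}$ subsets $Y_m\subseteq Y$ of size $m$, there exists a subset $X\subseteq Y_m$ with $|X|\le k$ such that $Y_m\setminus X$ contains at most $2^sT|\mathcal S|(m/N)^s$ sets from $\mathcal S$.
   Formalization: The parameter T ranges over the rationals greater than 1. -}

module Defs where

open import Data.Nat as ℕ using (ℕ; zero; suc)
open import Data.Integer using (+_)
open import Data.Rational using (ℚ; _/_; _*_; 1ℚ)
open import Data.List using (List; filter; length)
open import Data.Fin.Subset using (Subset; _⊆_)
open import Data.Fin.Subset.Properties using (_⊆?_)

ℕ→ℚ : ℕ → ℚ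
ℕ→ℚ n = + n / 1

infixr 8 _^ℚ_
_^ℚ_ : ℚ → ℕ → ℚ
q ^ℚ zero  = 1ℚ
q ^ℚ suc n = q * (q ^ℚ n)

-- number of members of the family 𝒮 (a duplicate-free list of subsets)
-- contained in the set Z
countInside : ∀ {N} → List (Subset N) → Subset N → ℕ
countInside 𝒮 Z = length (filter (_⊆? Z) 𝒮)

-- Put r = ⌊k/s⌋ + 1, so that k ≤ rs ≤ k + s. If Y is a bad m-set, then for every
-- U ⊆ Y with |U| ≤ k more than τ = T |𝒮| mˢ / Nˢ members of 𝒮 lie inside Y ∖ U. Choosing them
-- one after another, Y contains at least τʳ chains (A₁, …, A_r) of pairwise disjoint members of
-- 𝒮 (the union of the first r − 1 of them has at most k elements). Counted the other way round,
-- there are at most |𝒮|ʳ such chains, and the union of each, an (rs)-set, lies in at most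
-- C(N − rs, m − rs) ≤ C(N, m) (m/N)ʳˢ sets of size m. Hence |bad| τʳ ≤ C(N, m) |𝒮|ʳ (m/N)ʳˢ,
-- that is |bad| Tʳ ≤ C(N, m), and raising to the power s gives |bad|ˢ Tᵏ ≤ |bad|ˢ Tʳˢ ≤ C(N, m)ˢ.

module Submission where

open import Defs
open import Algebra.Bundles using (CommutativeRing)
import Algebra.Properties.CommutativeSemiring.Exp as SemiringExp
open import Data.Bool using (true; false; if_then_else_)
import Data.Bool as Bool
open import Data.Empty using (⊥-elim)
import Data.Fin as Fin
open import Data.Fin.Subset using (Subset; Side; inside; outside; _⊆_; _─_; _∪_; ∁; ⊥; ∣_∣)
open import Data.Fin.Subset.Properties
  using (_⊆?_; ⊆-trans; ⊥⊆; drop-∷-⊆; x∈p∪q⁻; p─q⊆p; ∣⊥∣≡0; ∣p∣≤n; ∣p─q∣≤∣p∣; p⊆q⇒∣p∣≤∣q∣)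
import Data.Integer as ℤ
import Data.Integer.Properties as ℤₚ
open import Data.List using (List; []; _∷_; length; map; filter)
open import Data.List.Properties using (filter-all; map-cong)
open import Data.List.Relation.Unary.All as All using (All; []; _∷_)
open import Data.List.Relation.Unary.All.Properties using (all-filter; filter⁺)
open import Data.List.Relation.Unary.AllPairs using ([]; _∷_)
open import Data.List.Relation.Unary.Unique.Propositional using (Unique)
import Data.List.Relation.Unary.Unique.Propositional.Properties as Unique
open import Data.Nat using (ℕ; zero; suc; _+_; _*_; _^_; _∸_; _≤_; _<_; _≤′_; ≤′-refl; ≤′-step; z≤n; s≤s; NonZero; >-nonZero)
open import Data.Nat.Properties
open import Data.Nat.Combinatorics using (_C_; nC1≡n; k>n⇒nCk≡0; nCk+nC[k+1]≡[n+1]C[k+1])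
open import Data.Nat.Coprimality using (1-coprimeTo) renaming (sym to coprime-sym)
open import Data.Nat.DivMod using (_/_; m≡m%n+[m/n]*n; m%n<n; m/n*n≤m)
open import Data.Nat.ListAction using (sum)
open import Data.Nat.Tactic.RingSolver using (solve-∀)
open import Data.Product using (∃; _×_; _,_; proj₁; proj₂)
import Data.Product as Product
open import Data.Rational as Q using (ℚ; mkℚ; 0ℚ; 1ℚ; _>_)
import Data.Rational.Properties as ℚₚ
open import Data.Sum using ([_,_]′)
open import Data.Vec using ([]; _∷_; here; there)
open import Function using (_∘_)
open import Relation.Binary.PropositionalEquality
open import Relation.Nullary using (¬_; yes; no; does)
open import Relation.Unary using (Decidable)

ℕ→ℚ≡mkℚ : ∀ n → ℕ→ℚ n ≡ mkℚ (ℤ.+ n) 0 (coprime-sym (1-coprimeTo n))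
ℕ→ℚ≡mkℚ n = ℚₚ.normalize-coprime (coprime-sym (1-coprimeTo n))

ℕ→ℚ-+ : ∀ a b → ℕ→ℚ (a + b) ≡ ℕ→ℚ a Q.+ ℕ→ℚ b
ℕ→ℚ-+ a b rewrite ℕ→ℚ≡mkℚ a | ℕ→ℚ≡mkℚ b =
  cong (Q._/ 1) (trans (ℤₚ.pos-+ a b) (sym (cong₂ ℤ._+_ (ℤₚ.*-identityʳ (ℤ.+ a)) (ℤₚ.*-identityʳ (ℤ.+ b)))))

ℕ→ℚ-* : ∀ a b → ℕ→ℚ (a * b) ≡ ℕ→ℚ a Q.* ℕ→ℚ b
ℕ→ℚ-* a b rewrite ℕ→ℚ≡mkℚ a | ℕ→ℚ≡mkℚ b = cong (Q._/ 1) (ℤₚ.pos-* a b)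

ℕ→ℚ-^ : ∀ a n → ℕ→ℚ (a ^ n) ≡ ℕ→ℚ a ^ℚ n
ℕ→ℚ-^ a zero    = refl
ℕ→ℚ-^ a (suc n) = trans (ℕ→ℚ-* a (a ^ n)) (cong (ℕ→ℚ a Q.*_) (ℕ→ℚ-^ a n))

ℕ→ℚ-mono-≤ : ∀ {a b} → a ≤ b → ℕ→ℚ a Q.≤ ℕ→ℚ b
ℕ→ℚ-mono-≤ {a} {b} a≤b rewrite ℕ→ℚ≡mkℚ a | ℕ→ℚ≡mkℚ b =
  Q.*≤* (subst₂ ℤ._≤_ (sym (ℤₚ.*-identityʳ (ℤ.+ a))) (sym (ℤₚ.*-identityʳ (ℤ.+ b))) (ℤ.+≤+ a≤b))

ℕ→ℚ-nonNeg : ∀ n → 0ℚ Q.≤ ℕ→ℚ n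
ℕ→ℚ-nonNeg n = ℕ→ℚ-mono-≤ {0} {n} z≤n

ℕ→ℚ-pos : ∀ n .{{_ : NonZero n}} → Q.Positive (ℕ→ℚ n)
ℕ→ℚ-pos (suc n) rewrite ℕ→ℚ≡mkℚ (suc n) = _

*-monoˡ-≤-0≤ : ∀ {r p q} → 0ℚ Q.≤ r → p Q.≤ q → r Q.* p Q.≤ r Q.* q
*-monoˡ-≤-0≤ {r} 0≤r = ℚₚ.*-monoˡ-≤-nonNeg r {{Q.nonNegative 0≤r}}

*-monoʳ-≤-0≤ : ∀ {r p q} → 0ℚ Q.≤ r → p Q.≤ q → p Q.* r Q.≤ q Q.* r
*-monoʳ-≤-0≤ {r} 0≤r = ℚₚ.*-monoʳ-≤-nonNeg r {{Q.nonNegative 0≤r}}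

*-nonNeg : ∀ {p q} → 0ℚ Q.≤ p → 0ℚ Q.≤ q → 0ℚ Q.≤ p Q.* q
*-nonNeg {p} {q} 0≤p 0≤q = subst (Q._≤ p Q.* q) (ℚₚ.*-zeroˡ q) (*-monoʳ-≤-0≤ 0≤q 0≤p)

module ℚ^ = SemiringExp (CommutativeRing.commutativeSemiring ℚₚ.+-*-commutativeRing)

^ℚ≡^ : ∀ p n → p ^ℚ n ≡ p ℚ^.^ n
^ℚ≡^ p zero    = refl
^ℚ≡^ p (suc n) = cong (p Q.*_) (^ℚ≡^ p n)

^ℚ-distrib-* : ∀ p q n → (p Q.* q) ^ℚ n ≡ p ^ℚ n Q.* q ^ℚ n
^ℚ-distrib-* p q n = begin
  (p Q.* q) ^ℚ n          ≡⟨ ^ℚ≡^ (p Q.* q) n ⟩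
  (p Q.* q) ℚ^.^ n        ≡⟨ ℚ^.^-distrib-* p q n ⟩
  p ℚ^.^ n Q.* q ℚ^.^ n   ≡⟨ cong₂ Q._*_ (^ℚ≡^ p n) (^ℚ≡^ q n) ⟨
  p ^ℚ n Q.* q ^ℚ n       ∎
  where open ≡-Reasoning

^ℚ-*-assoc : ∀ p m n → (p ^ℚ m) ^ℚ n ≡ p ^ℚ (m * n)
^ℚ-*-assoc p m n = begin
  (p ^ℚ m) ^ℚ n        ≡⟨ ^ℚ≡^ (p ^ℚ m) n ⟩
  (p ^ℚ m) ℚ^.^ n      ≡⟨ cong (ℚ^._^ n) (^ℚ≡^ p m) ⟩
  (p ℚ^.^ m) ℚ^.^ n    ≡⟨ ℚ^.^-assocʳ p m n ⟩
  p ℚ^.^ (m * n)       ≡⟨ ^ℚ≡^ p (m * n) ⟨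
  p ^ℚ (m * n)         ∎
  where open ≡-Reasoning

^ℚ-nonNeg : ∀ {p} n → 0ℚ Q.≤ p → 0ℚ Q.≤ p ^ℚ n
^ℚ-nonNeg zero    0≤p = ℕ→ℚ-nonNeg 1
^ℚ-nonNeg (suc n) 0≤p = *-nonNeg 0≤p (^ℚ-nonNeg n 0≤p)

^ℚ-monoˡ-≤ : ∀ {p q} n → 0ℚ Q.≤ p → p Q.≤ q → p ^ℚ n Q.≤ q ^ℚ n
^ℚ-monoˡ-≤ zero    0≤p p≤q = ℚₚ.≤-refl
^ℚ-monoˡ-≤ (suc n) 0≤p p≤q = ℚₚ.≤-trans (*-monoʳ-≤-0≤ (^ℚ-nonNeg n 0≤p) p≤q)
  (*-monoˡ-≤-0≤ (ℚₚ.≤-trans 0≤p p≤q) (^ℚ-monoˡ-≤ n 0≤p p≤q))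

^ℚ-monoʳ-≤ : ∀ {p m n} → 1ℚ Q.≤ p → m ≤′ n → p ^ℚ m Q.≤ p ^ℚ n
^ℚ-monoʳ-≤         1≤p ≤′-refl            = ℚₚ.≤-refl
^ℚ-monoʳ-≤ {p} {m} 1≤p (≤′-step {n} m≤n) = begin
  p ^ℚ m          ≤⟨ ^ℚ-monoʳ-≤ 1≤p m≤n ⟩
  p ^ℚ n          ≡⟨ ℚₚ.*-identityˡ (p ^ℚ n) ⟨
  1ℚ Q.* p ^ℚ n   ≤⟨ *-monoʳ-≤-0≤ (^ℚ-nonNeg n (ℚₚ.≤-trans (ℕ→ℚ-nonNeg 1) 1≤p)) 1≤p ⟩
  p Q.* p ^ℚ n    ∎
  where open ℚₚ.≤-Reasoning

-- Binomial coefficients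

[n+1]C[k+1]*[k+1]≡[n+1]*nCk : ∀ n k → (suc n C suc k) * suc k ≡ suc n * (n C k)
[n+1]C[k+1]*[k+1]≡[n+1]*nCk n       zero    =
  trans (*-identityʳ (suc n C 1)) (trans (nC1≡n (suc n)) (sym (*-identityʳ (suc n))))
[n+1]C[k+1]*[k+1]≡[n+1]*nCk zero    (suc k) = cong (_* suc (suc k)) (k>n⇒nCk≡0 {1} {suc (suc k)} (s≤s (s≤s z≤n)))
[n+1]C[k+1]*[k+1]≡[n+1]*nCk (suc n) (suc k) = begin
  (suc (suc n) C suc (suc k)) * suc (suc k)
    ≡⟨ cong (_* suc (suc k)) (nCk+nC[k+1]≡[n+1]C[k+1] (suc n) (suc k)) ⟨
  (a + b) * suc (suc k)
    ≡⟨ expand a b k ⟩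
  a * suc k + a + b * suc (suc k)
    ≡⟨ cong₂ (λ x y → x + a + y) ([n+1]C[k+1]*[k+1]≡[n+1]*nCk n k) ([n+1]C[k+1]*[k+1]≡[n+1]*nCk n (suc k)) ⟩
  suc n * (n C k) + a + suc n * (n C suc k)
    ≡⟨ collect a (n C k) (n C suc k) n ⟩
  a + suc n * ((n C k) + (n C suc k))
    ≡⟨ cong (λ x → a + suc n * x) (nCk+nC[k+1]≡[n+1]C[k+1] n k) ⟩
  suc (suc n) * a
    ∎
  where
  open ≡-Reasoning
  a = suc n C suc k
  b = suc n C suc (suc k)
  expand : ∀ x y k → (x + y) * suc (suc k) ≡ x * suc k + x + y * suc (suc k)
  expand = solve-∀
  collect : ∀ x p q n → suc n * p + x + suc n * q ≡ x + suc n * (p + q)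
  collect = solve-∀

nCk*[n+1+u]≤[n+1]C[k+1]*[k+1+u] : ∀ n k u → (n C k) * (suc n + u) ≤ (suc n C suc k) * (suc k + u)
nCk*[n+1+u]≤[n+1]C[k+1]*[k+1+u] n k u with n <? k
... | yes n<k rewrite k>n⇒nCk≡0 n<k = z≤n
... | no  n≮k = *-cancelʳ-≤ _ _ (suc k) (begin
  c * (suc n + u) * suc k            ≡⟨ expand c n k u ⟩
  c * (suc n * suc k + u * suc k)    ≤⟨ *-monoʳ-≤ c (+-monoʳ-≤ (suc n * suc k) (*-monoʳ-≤ u (s≤s (≮⇒≥ n≮k)))) ⟩
  c * (suc n * suc k + u * suc n)    ≡⟨ regroup c n k u ⟩
  suc n * c * (suc k + u)            ≡⟨ cong (_* (suc k + u)) ([n+1]C[k+1]*[k+1]≡[n+1]*nCk n k) ⟨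
  c′ * suc k * (suc k + u)           ≡⟨ swap c′ (suc k) (suc k + u) ⟩
  c′ * (suc k + u) * suc k           ∎)
  where
  open ≤-Reasoning
  c = n C k
  c′ = suc n C suc k
  expand : ∀ c n k u → c * (suc n + u) * suc k ≡ c * (suc n * suc k + u * suc k)
  expand = solve-∀
  regroup : ∀ c n k u → c * (suc n * suc k + u * suc n) ≡ suc n * c * (suc k + u)
  regroup = solve-∀
  swap : ∀ a b c → a * b * c ≡ a * c * b
  swap = solve-∀

nCk*[n+u]^u≤[n+u]C[k+u]*[k+u]^u : ∀ n k u → (n C k) * (n + u) ^ u ≤ ((n + u) C (k + u)) * (k + u) ^ u
nCk*[n+u]^u≤[n+u]C[k+u]*[k+u]^u n k zero rewrite +-identityʳ n | +-identityʳ k = ≤-refl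
nCk*[n+u]^u≤[n+u]C[k+u]*[k+u]^u n k (suc u) rewrite +-suc n u | +-suc k u = begin
  (n C k) * (n′ * n′ ^ u)                   ≡⟨ *-assoc (n C k) n′ (n′ ^ u) ⟨
  (n C k) * n′ * n′ ^ u                     ≤⟨ *-monoˡ-≤ (n′ ^ u) (nCk*[n+1+u]≤[n+1]C[k+1]*[k+1+u] n k u) ⟩
  (suc n C suc k) * k′ * n′ ^ u             ≡⟨ rotate (suc n C suc k) k′ (n′ ^ u) ⟩
  k′ * ((suc n C suc k) * n′ ^ u)           ≤⟨ *-monoʳ-≤ k′ (nCk*[n+u]^u≤[n+u]C[k+u]*[k+u]^u (suc n) (suc k) u) ⟩
  k′ * ((n′ C k′) * k′ ^ u)                 ≡⟨ rotate′ k′ (n′ C k′) (k′ ^ u) ⟩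
  (n′ C k′) * (k′ * k′ ^ u)                 ∎
  where
  open ≤-Reasoning
  n′ = suc (n + u)
  k′ = suc (k + u)
  rotate : ∀ a b c → a * b * c ≡ b * (a * c)
  rotate = solve-∀
  rotate′ : ∀ a b c → a * (b * c) ≡ b * (a * c)
  rotate′ = solve-∀

-- Counting supersets

All⇒≡[] : ∀ {A : Set} {P : A → Set} {xs} → (∀ {x} → ¬ P x) → All P xs → xs ≡ []
All⇒≡[] ¬P []       = refl
All⇒≡[] ¬P (px ∷ _) = ⊥-elim (¬P px)

tailsWith : ∀ {n} → Side → List (Subset (suc n)) → List (Subset n)
tailsWith b []             = []
tailsWith b ((x ∷ p) ∷ ps) with x Bool.≟ b
... | yes _ = p ∷ tailsWith b ps
... | no  _ = tailsWith b ps

length-tailsWith : ∀ {n} (ps : List (Subset (suc n))) →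
                   length ps ≡ length (tailsWith outside ps) + length (tailsWith inside ps)
length-tailsWith []                   = refl
length-tailsWith ((outside ∷ p) ∷ ps) = cong suc (length-tailsWith ps)
length-tailsWith ((inside  ∷ p) ∷ ps) = trans (cong suc (length-tailsWith ps)) (sym (+-suc _ _))

All-tailsWith : ∀ {n} {P : Subset (suc n) → Set} b {ps} → All P ps → All (λ p → P (b ∷ p)) (tailsWith b ps)
All-tailsWith b {[]}           []          = []
All-tailsWith b {(x ∷ p) ∷ ps} (Pxp ∷ Pps) with x Bool.≟ b
... | yes refl = Pxp ∷ All-tailsWith b Pps
... | no  _    = All-tailsWith b Pps

Unique-tailsWith : ∀ {n} b {ps : List (Subset (suc n))} → Unique ps → Unique (tailsWith b ps)
Unique-tailsWith b {[]}           []           = []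
Unique-tailsWith b {(x ∷ p) ∷ ps} (x∷p∉ps ∷ u) with x Bool.≟ b
... | yes refl = All.map (λ ≢ → ≢ ∘ cong (x ∷_)) (All-tailsWith b x∷p∉ps) ∷ Unique-tailsWith b u
... | no  _    = Unique-tailsWith b u

inside∷p⊈outside∷q : ∀ {n} {p q : Subset n} → ¬ (inside ∷ p ⊆ outside ∷ q)
inside∷p⊈outside∷q ⊆ with ⊆ here
... | ()

p⊆r∧q⊆r⇒p∪q⊆r : ∀ {n} {p q r : Subset n} → p ⊆ r → q ⊆ r → p ∪ q ⊆ r
p⊆r∧q⊆r⇒p∪q⊆r {p = p} {q} p⊆r q⊆r x∈p∪q = [ p⊆r , q⊆r ]′ (x∈p∪q⁻ p q x∈p∪q)

p─q⊆∁q : ∀ {n} (p q : Subset n) → p ─ q ⊆ ∁ q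
p─q⊆∁q (inside  ∷ p) (outside ∷ q) here       = here
p─q⊆∁q (inside  ∷ p) (inside  ∷ q) {Fin.zero} ()
p─q⊆∁q (outside ∷ p) (outside ∷ q) {Fin.zero} ()
p─q⊆∁q (outside ∷ p) (inside  ∷ q) {Fin.zero} ()
p─q⊆∁q (_       ∷ p) (_       ∷ q) (there x∈) = there (p─q⊆∁q p q x∈)

∣p∪q∣≡∣p∣+∣q∣ : ∀ {n} (p q : Subset n) → q ⊆ ∁ p → ∣ p ∪ q ∣ ≡ ∣ p ∣ + ∣ q ∣
∣p∪q∣≡∣p∣+∣q∣ []            []            _    = refl
∣p∪q∣≡∣p∣+∣q∣ (outside ∷ p) (outside ∷ q) q⊆∁p = ∣p∪q∣≡∣p∣+∣q∣ p q (drop-∷-⊆ q⊆∁p)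
∣p∪q∣≡∣p∣+∣q∣ (outside ∷ p) (inside  ∷ q) q⊆∁p =
  trans (cong suc (∣p∪q∣≡∣p∣+∣q∣ p q (drop-∷-⊆ q⊆∁p))) (sym (+-suc ∣ p ∣ ∣ q ∣))
∣p∪q∣≡∣p∣+∣q∣ (inside  ∷ p) (outside ∷ q) q⊆∁p = cong suc (∣p∪q∣≡∣p∣+∣q∣ p q (drop-∷-⊆ q⊆∁p))
∣p∪q∣≡∣p∣+∣q∣ (inside  ∷ p) (inside  ∷ q) q⊆∁p = ⊥-elim (inside∷p⊈outside∷q q⊆∁p)

-- Split the supersets of u according to their first entry; Pascal's rule then does the rest.
supersets-length≤C : ∀ {n} (u : Subset n) j {qs} → Unique qs →
                     All (λ q → u ⊆ q × ∣ q ∣ ≡ j + ∣ u ∣) qs → length qs ≤ (n ∸ ∣ u ∣) C j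
supersets-length≤C []            j       {[]}          _             _               = z≤n
supersets-length≤C []            zero    {[] ∷ []}     _             _               = ≤-refl
supersets-length≤C []            (suc j) {[] ∷ []}     _             ((_ , ()) ∷ [])
supersets-length≤C []            j       {[] ∷ [] ∷ _} ((≢ ∷ _) ∷ _) _               = ⊥-elim (≢ refl)
supersets-length≤C {suc n} (inside ∷ u) j {qs} uniq sup = begin
  length qs                  ≡⟨ length-tailsWith qs ⟩
  length outs + length ins   ≡⟨ cong (λ xs → length xs + length ins) no-outs ⟩
  length ins                 ≤⟨ supersets-length≤C u j (Unique-tailsWith inside uniq) ins-sup ⟩
  (n ∸ ∣ u ∣) C j            ∎
  where
  open ≤-Reasoning
  outs = tailsWith outside qs
  ins  = tailsWith inside qs
  no-outs : outs ≡ []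
  no-outs = All⇒≡[] (inside∷p⊈outside∷q ∘ proj₁) (All-tailsWith outside sup)
  ins-sup : All (λ q → u ⊆ q × ∣ q ∣ ≡ j + ∣ u ∣) ins
  ins-sup = All.map (Product.map drop-∷-⊆ (λ eq → suc-injective (trans eq (+-suc j ∣ u ∣))))
                    (All-tailsWith inside sup)
supersets-length≤C {suc n} (outside ∷ u) j {qs} uniq sup = begin
  length qs                  ≡⟨ length-tailsWith qs ⟩
  length outs + length ins   ≤⟨ +-monoˡ-≤ (length ins) (supersets-length≤C u j (Unique-tailsWith outside uniq) outs-sup) ⟩
  (a C j) + length ins       ≤⟨ with-ins j (Unique-tailsWith inside uniq) (All-tailsWith inside sup) ⟩
  (suc n ∸ ∣ u ∣) C j        ∎
  where
  open ≤-Reasoning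
  a    = n ∸ ∣ u ∣
  outs = tailsWith outside qs
  ins  = tailsWith inside qs
  outs-sup : All (λ q → u ⊆ q × ∣ q ∣ ≡ j + ∣ u ∣) outs
  outs-sup = All.map (Product.map₁ drop-∷-⊆) (All-tailsWith outside sup)
  with-ins : ∀ j {ps} → Unique ps → All (λ p → outside ∷ u ⊆ inside ∷ p × suc ∣ p ∣ ≡ j + ∣ u ∣) ps →
             (a C j) + length ps ≤ (suc n ∸ ∣ u ∣) C j
  with-ins zero ins-uniq ins-sup
    rewrite All⇒≡[] (λ (⊆ , ∣p∣≡) → <-irrefl (sym ∣p∣≡) (s≤s (p⊆q⇒∣p∣≤∣q∣ (drop-∷-⊆ ⊆)))) ins-sup = ≤-refl
  with-ins (suc j) {ps} ins-uniq ins-sup = begin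
    (a C suc j) + length ps    ≤⟨ +-monoʳ-≤ (a C suc j) (supersets-length≤C u j ins-uniq
                                    (All.map (Product.map drop-∷-⊆ suc-injective) ins-sup)) ⟩
    (a C suc j) + (a C j)      ≡⟨ +-comm (a C suc j) (a C j) ⟩
    (a C j) + (a C suc j)      ≡⟨ nCk+nC[k+1]≡[n+1]C[k+1] a j ⟩
    suc a C suc j              ≡⟨ cong (_C suc j) (+-∸-assoc 1 (∣p∣≤n u)) ⟨
    (suc n ∸ ∣ u ∣) C suc j    ∎
supersets-length*n^∣u∣≤nCm*m^∣u∣ : ∀ {n m} (u : Subset n) {qs} → Unique qs → All (λ q → u ⊆ q × ∣ q ∣ ≡ m) qs →
                                   length qs * n ^ ∣ u ∣ ≤ (n C m) * m ^ ∣ u ∣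
supersets-length*n^∣u∣≤nCm*m^∣u∣                 u {[]}    _    _                        = z≤n
supersets-length*n^∣u∣≤nCm*m^∣u∣ {n} {m} u {q ∷ qs} uniq sup@((u⊆q , ∣q∣≡m) ∷ _) = begin
  length (q ∷ qs) * n ^ ∣ u ∣                  ≤⟨ *-monoˡ-≤ (n ^ ∣ u ∣) (supersets-length≤C u (m ∸ ∣ u ∣) uniq sup′) ⟩
  ((n ∸ ∣ u ∣) C (m ∸ ∣ u ∣)) * n ^ ∣ u ∣      ≡⟨ cong (λ x → ((n ∸ ∣ u ∣) C (m ∸ ∣ u ∣)) * x ^ ∣ u ∣) n∸u+u≡n ⟨
  ((n ∸ ∣ u ∣) C (m ∸ ∣ u ∣)) * (n ∸ ∣ u ∣ + ∣ u ∣) ^ ∣ u ∣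
    ≤⟨ nCk*[n+u]^u≤[n+u]C[k+u]*[k+u]^u (n ∸ ∣ u ∣) (m ∸ ∣ u ∣) ∣ u ∣ ⟩
  ((n ∸ ∣ u ∣ + ∣ u ∣) C (m ∸ ∣ u ∣ + ∣ u ∣)) * (m ∸ ∣ u ∣ + ∣ u ∣) ^ ∣ u ∣
    ≡⟨ cong₂ (λ x y → (x C y) * y ^ ∣ u ∣) n∸u+u≡n m∸u+u≡m ⟩
  (n C m) * m ^ ∣ u ∣                          ∎
  where
  open ≤-Reasoning
  u≤m : ∣ u ∣ ≤ m
  u≤m = subst (∣ u ∣ ≤_) ∣q∣≡m (p⊆q⇒∣p∣≤∣q∣ u⊆q)
  m∸u+u≡m : m ∸ ∣ u ∣ + ∣ u ∣ ≡ m
  m∸u+u≡m = m∸n+n≡m u≤m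
  n∸u+u≡n : n ∸ ∣ u ∣ + ∣ u ∣ ≡ n
  n∸u+u≡n = m∸n+n≡m (≤-trans u≤m (subst (_≤ n) ∣q∣≡m (∣p∣≤n q)))
  sup′ : All (λ q → u ⊆ q × ∣ q ∣ ≡ m ∸ ∣ u ∣ + ∣ u ∣) (q ∷ qs)
  sup′ = All.map (Product.map₂ (λ ∣q∣≡m → trans ∣q∣≡m (sym m∸u+u≡m))) sup


sum-map-const : ∀ {A : Set} c (xs : List A) → sum (map (λ _ → c) xs) ≡ length xs * c
sum-map-const c []       = refl
sum-map-const c (x ∷ xs) = cong (c +_) (sum-map-const c xs)

sum-map-+ : ∀ {A : Set} (f g : A → ℕ) xs → sum (map (λ x → f x + g x) xs) ≡ sum (map f xs) + sum (map g xs)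
sum-map-+ f g []       = refl
sum-map-+ f g (x ∷ xs) =
  trans (cong (f x + g x +_) (sum-map-+ f g xs)) (interchange (f x) (g x) (sum (map f xs)) (sum (map g xs)))
  where
  interchange : ∀ a b c d → a + b + (c + d) ≡ a + c + (b + d)
  interchange = solve-∀

sum-map-swap : ∀ {A B : Set} (f : A → B → ℕ) xs ys →
               sum (map (λ x → sum (map (f x) ys)) xs) ≡ sum (map (λ y → sum (map (λ x → f x y) xs)) ys)
sum-map-swap f []       ys = sym (trans (sum-map-const 0 ys) (*-zeroʳ (length ys)))
sum-map-swap f (x ∷ xs) ys = trans (cong (sum (map (f x) ys) +_) (sum-map-swap f xs ys))
                                   (sym (sum-map-+ (f x) (λ y → sum (map (λ x → f x y) xs)) ys))

sum-map-filter : ∀ {A : Set} {P : A → Set} (P? : Decidable P) (f : A → ℕ) xs →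
                 sum (map f (filter P? xs)) ≡ sum (map (λ x → if does (P? x) then f x else 0) xs)
sum-map-filter P? f []       = refl
sum-map-filter P? f (x ∷ xs) with does (P? x)
... | true  = cong (f x +_) (sum-map-filter P? f xs)
... | false = sum-map-filter P? f xs

sum-map-mono-≤ : ∀ {A : Set} {f g : A → ℕ} → (∀ x → f x ≤ g x) → ∀ xs → sum (map f xs) ≤ sum (map g xs)
sum-map-mono-≤ f≤g []       = z≤n
sum-map-mono-≤ f≤g (x ∷ xs) = +-mono-≤ (f≤g x) (sum-map-mono-≤ f≤g xs)

sum-map-*≤length* : ∀ {A : Set} (f : A → ℕ) {K B xs} → All (λ x → f x * K ≤ B) xs →
                    sum (map f xs) * K ≤ length xs * B
sum-map-*≤length* f                {xs = []}     []           = z≤n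
sum-map-*≤length* f {K} {B} {x ∷ xs} (fxK≤B ∷ h) = begin
  (f x + sum (map f xs)) * K       ≡⟨ *-distribʳ-+ K (f x) (sum (map f xs)) ⟩
  f x * K + sum (map f xs) * K     ≤⟨ +-mono-≤ fxK≤B (sum-map-*≤length* f h) ⟩
  B + length xs * B                ∎
  where open ≤-Reasoning

length*≤sum-map* : ∀ {A : Set} (f : A → ℕ) {M q xs} → All (λ x → q Q.≤ ℕ→ℚ (f x * M)) xs →
                   ℕ→ℚ (length xs) Q.* q Q.≤ ℕ→ℚ (sum (map f xs) * M)
length*≤sum-map* f         {q = q} {[]} []           = ℚₚ.≤-reflexive (ℚₚ.*-zeroˡ q)
length*≤sum-map* f {M} {q} {x ∷ xs} (q≤fxM ∷ h) = begin
  ℕ→ℚ (1 + length xs) Q.* q                         ≡⟨ cong (Q._* q) (ℕ→ℚ-+ 1 (length xs)) ⟩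
  (1ℚ Q.+ ℕ→ℚ (length xs)) Q.* q                    ≡⟨ ℚₚ.*-distribʳ-+ q 1ℚ (ℕ→ℚ (length xs)) ⟩
  1ℚ Q.* q Q.+ ℕ→ℚ (length xs) Q.* q                ≡⟨ cong (Q._+ ℕ→ℚ (length xs) Q.* q) (ℚₚ.*-identityˡ q) ⟩
  q Q.+ ℕ→ℚ (length xs) Q.* q                       ≤⟨ ℚₚ.+-mono-≤ q≤fxM (length*≤sum-map* f h) ⟩
  ℕ→ℚ (f x * M) Q.+ ℕ→ℚ (sum (map f xs) * M)        ≡⟨ ℕ→ℚ-+ (f x * M) (sum (map f xs) * M) ⟨
  ℕ→ℚ (f x * M + sum (map f xs) * M)                ≡⟨ cong ℕ→ℚ (*-distribʳ-+ M (f x) (sum (map f xs))) ⟨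
  ℕ→ℚ ((f x + sum (map f xs)) * M)                  ∎
  where open ℚₚ.≤-Reasoning

-- Chains of disjoint members

module _ {N : ℕ} (𝒮 : List (Subset N)) where

  -- chains r Y U counts the sequences (A₁, …, A_r) of members of 𝒮 with Aᵢ ⊆ Y ∖ (U ∪ A₁ ∪ … ∪ Aᵢ₋₁).
  chains : ℕ → Subset N → Subset N → ℕ
  chains zero    Y U = 1
  chains (suc r) Y U = sum (map (λ A → chains r Y (U ∪ A)) (filter (_⊆? (Y ─ U)) 𝒮))

  -- The hypothesis on ∣ U ∣ + r * s keeps every U met along the way of size at most k.
  chains-lower : ∀ {s k Y} (τ : ℚ) → 0ℚ Q.≤ τ → All (λ A → ∣ A ∣ ≡ s) 𝒮 →
                 (∀ U → U ⊆ Y → ∣ U ∣ ≤ k → τ Q.≤ ℕ→ℚ (countInside 𝒮 (Y ─ U) * N ^ s)) →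
                 ∀ r U → U ⊆ Y → ∣ U ∣ + r * s ≤ k + s → τ ^ℚ r Q.≤ ℕ→ℚ (chains r Y U * (N ^ s) ^ r)
  chains-lower τ _ _ _ zero _ _ _ = ℚₚ.≤-refl
  chains-lower {s} {k} {Y} τ 0≤τ sizes dense (suc r) U U⊆Y bound = begin
    τ Q.* τ ^ℚ r                                        ≤⟨ *-monoʳ-≤-0≤ (^ℚ-nonNeg r 0≤τ) (dense U U⊆Y ∣U∣≤k) ⟩
    ℕ→ℚ (length F * N ^ s) Q.* τ ^ℚ r                   ≡⟨ cong (Q._* τ ^ℚ r) (ℕ→ℚ-* (length F) (N ^ s)) ⟩
    ℕ→ℚ (length F) Q.* ℕ→ℚ (N ^ s) Q.* τ ^ℚ r           ≡⟨ cong (Q._* τ ^ℚ r) (ℚₚ.*-comm (ℕ→ℚ (length F)) _) ⟩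
    ℕ→ℚ (N ^ s) Q.* ℕ→ℚ (length F) Q.* τ ^ℚ r           ≡⟨ ℚₚ.*-assoc (ℕ→ℚ (N ^ s)) _ _ ⟩
    ℕ→ℚ (N ^ s) Q.* (ℕ→ℚ (length F) Q.* τ ^ℚ r)         ≤⟨ *-monoˡ-≤-0≤ (ℕ→ℚ-nonNeg (N ^ s)) (length*≤sum-map* g each) ⟩
    ℕ→ℚ (N ^ s) Q.* ℕ→ℚ (sum (map g F) * (N ^ s) ^ r)   ≡⟨ ℕ→ℚ-* (N ^ s) _ ⟨
    ℕ→ℚ (N ^ s * (sum (map g F) * (N ^ s) ^ r))         ≡⟨ cong ℕ→ℚ (x∙yz≡y∙xz (N ^ s) (sum (map g F)) _) ⟩
    ℕ→ℚ (sum (map g F) * (N ^ s * (N ^ s) ^ r))         ∎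
    where
    open ℚₚ.≤-Reasoning
    F = filter (_⊆? (Y ─ U)) 𝒮
    g = λ A → chains r Y (U ∪ A)
    x∙yz≡y∙xz : ∀ x y z → x * (y * z) ≡ y * (x * z)
    x∙yz≡y∙xz = solve-∀
    ∣U∣≤k : ∣ U ∣ ≤ k
    ∣U∣≤k = +-cancelʳ-≤ s ∣ U ∣ k (≤-trans (+-monoʳ-≤ ∣ U ∣ (m≤m+n s (r * s))) bound)
    step : ∀ {A} → A ⊆ Y ─ U × ∣ A ∣ ≡ s → τ ^ℚ r Q.≤ ℕ→ℚ (g A * (N ^ s) ^ r)
    step {A} (A⊆Y─U , ∣A∣≡s) = chains-lower τ 0≤τ sizes dense r (U ∪ A)
      (p⊆r∧q⊆r⇒p∪q⊆r U⊆Y (⊆-trans A⊆Y─U (p─q⊆p Y U)))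
      (subst (λ x → x + r * s ≤ k + s) (sym ∣U∪A∣≡) (subst (_≤ k + s) (sym (+-assoc ∣ U ∣ s (r * s))) bound))
      where
      ∣U∪A∣≡ : ∣ U ∪ A ∣ ≡ ∣ U ∣ + s
      ∣U∪A∣≡ = trans (∣p∪q∣≡∣p∣+∣q∣ U A (⊆-trans A⊆Y─U (p─q⊆∁q Y U))) (cong (∣ U ∣ +_) ∣A∣≡s)
    each : All (λ A → τ ^ℚ r Q.≤ ℕ→ℚ (g A * (N ^ s) ^ r)) F
    each = All.map step (All.zip (all-filter (_⊆? (Y ─ U)) 𝒮 , filter⁺ (_⊆? (Y ─ U)) sizes))

  Σchains : List (Subset N) → ℕ → Subset N → ℕ
  Σchains ys r U = sum (map (λ Y → chains r Y U) (filter (U ⊆?_) ys))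

  -- The part of Σchains ys (suc r) U coming from chains that start with A.
  Σchains-from : List (Subset N) → ℕ → Subset N → Subset N → ℕ
  Σchains-from ys r U A =
    sum (map (λ Y → if does (A ⊆? (Y ─ U)) then chains r Y (U ∪ A) else 0) (filter (U ⊆?_) ys))

  Σchains-suc : ∀ ys r U → Σchains ys (suc r) U ≡ sum (map (Σchains-from ys r U) 𝒮)
  Σchains-suc ys r U = trans
    (cong sum (map-cong (λ Y → sum-map-filter (_⊆? (Y ─ U)) (λ A → chains r Y (U ∪ A)) 𝒮) (filter (U ⊆?_) ys)))
    (sum-map-swap (λ Y A → if does (A ⊆? (Y ─ U)) then chains r Y (U ∪ A) else 0) (filter (U ⊆?_) ys) 𝒮)

  Σchains-from≤Σchains : ∀ ys r U A → Σchains-from ys r U A ≤ Σchains ys r (U ∪ A)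
  Σchains-from≤Σchains ys r U A = begin
    Σchains-from ys r U A
      ≡⟨ sum-map-filter (U ⊆?_) (λ Y → if does (A ⊆? (Y ─ U)) then g Y else 0) ys ⟩
    sum (map (λ Y → if does (U ⊆? Y) then (if does (A ⊆? (Y ─ U)) then g Y else 0) else 0) ys)
      ≤⟨ sum-map-mono-≤ pointwise ys ⟩
    sum (map (λ Y → if does ((U ∪ A) ⊆? Y) then g Y else 0) ys)
      ≡⟨ sum-map-filter ((U ∪ A) ⊆?_) g ys ⟨
    Σchains ys r (U ∪ A)
      ∎
    where
    open ≤-Reasoning
    g = λ Y → chains r Y (U ∪ A)
    pointwise : ∀ Y → (if does (U ⊆? Y) then (if does (A ⊆? (Y ─ U)) then g Y else 0) else 0)
                      ≤ (if does ((U ∪ A) ⊆? Y) then g Y else 0)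
    pointwise Y with U ⊆? Y | A ⊆? (Y ─ U) | (U ∪ A) ⊆? Y
    ... | no  _   | _         | _         = z≤n
    ... | yes _   | no  _     | _         = z≤n
    ... | yes _   | yes _     | yes _     = ≤-refl
    ... | yes U⊆Y | yes A⊆Y─U | no  U∪A⊈Y =
      ⊥-elim (U∪A⊈Y (p⊆r∧q⊆r⇒p∪q⊆r U⊆Y (⊆-trans A⊆Y─U (p─q⊆p Y U))))

  Σchains-from≡0 : ∀ ys r U A → ¬ A ⊆ ∁ U → Σchains-from ys r U A ≡ 0
  Σchains-from≡0 ys r U A A⊈∁U = n≤0⇒n≡0 (begin
    Σchains-from ys r U A                             ≤⟨ sum-map-mono-≤ pointwise (filter (U ⊆?_) ys) ⟩
    sum (map (λ _ → 0) (filter (U ⊆?_) ys))           ≡⟨ sum-map-const 0 (filter (U ⊆?_) ys) ⟩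
    length (filter (U ⊆?_) ys) * 0                    ≡⟨ *-zeroʳ (length (filter (U ⊆?_) ys)) ⟩
    0                                                 ∎)
    where
    open ≤-Reasoning
    pointwise : ∀ Y → (if does (A ⊆? (Y ─ U)) then chains r Y (U ∪ A) else 0) ≤ 0
    pointwise Y with A ⊆? (Y ─ U)
    ... | yes A⊆Y─U = ⊥-elim (A⊈∁U (⊆-trans A⊆Y─U (p─q⊆∁q Y U)))
    ... | no  _     = z≤n

  Σchains-upper : ∀ {s m} → All (λ A → ∣ A ∣ ≡ s) 𝒮 → ∀ {ys} → Unique ys → All (λ Y → ∣ Y ∣ ≡ m) ys →
                  ∀ r U → Σchains ys r U * (N ^ ∣ U ∣ * (N ^ s) ^ r) ≤ (N C m) * m ^ ∣ U ∣ * (length 𝒮 * m ^ s) ^ r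
  Σchains-upper {m = m} sizes {ys} uniq ∣ys∣≡m zero U = begin
    Σchains ys 0 U * (N ^ ∣ U ∣ * 1)
      ≡⟨ cong₂ _*_ (trans (sum-map-const 1 zs) (*-identityʳ (length zs))) (*-identityʳ (N ^ ∣ U ∣)) ⟩
    length zs * N ^ ∣ U ∣
      ≤⟨ supersets-length*n^∣u∣≤nCm*m^∣u∣ U (Unique.filter⁺ (U ⊆?_) uniq)
           (All.zip (all-filter (U ⊆?_) ys , filter⁺ (U ⊆?_) ∣ys∣≡m)) ⟩
    (N C m) * m ^ ∣ U ∣
      ≡⟨ *-identityʳ ((N C m) * m ^ ∣ U ∣) ⟨
    (N C m) * m ^ ∣ U ∣ * 1
      ∎
    where
    open ≤-Reasoning
    zs = filter (U ⊆?_) ys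
  Σchains-upper {s} {m} sizes {ys} uniq ∣ys∣≡m (suc r) U = begin
    Σchains ys (suc r) U * K                  ≡⟨ cong (_* K) (Σchains-suc ys r U) ⟩
    sum (map (Σchains-from ys r U) 𝒮) * K     ≤⟨ sum-map-*≤length* (Σchains-from ys r U) (All.map each sizes) ⟩
    length 𝒮 * ((N C m) * m ^ (∣ U ∣ + s) * D ^ r)
      ≡⟨ cong (λ x → length 𝒮 * ((N C m) * x * D ^ r)) (^-distribˡ-+-* m ∣ U ∣ s) ⟩
    length 𝒮 * ((N C m) * (m ^ ∣ U ∣ * m ^ s) * D ^ r)
      ≡⟨ regroup (length 𝒮) (N C m) (m ^ ∣ U ∣) (m ^ s) (D ^ r) ⟩
    (N C m) * m ^ ∣ U ∣ * D ^ suc r           ∎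
    where
    open ≤-Reasoning
    D = length 𝒮 * m ^ s
    K = N ^ ∣ U ∣ * (N ^ s) ^ suc r
    B = (N C m) * m ^ (∣ U ∣ + s) * D ^ r
    regroup : ∀ l c x y z → l * (c * (x * y) * z) ≡ c * x * (l * y * z)
    regroup = solve-∀
    each : ∀ {A} → ∣ A ∣ ≡ s → Σchains-from ys r U A * K ≤ B
    each {A} ∣A∣≡s with A ⊆? ∁ U
    ... | no  A⊈∁U rewrite Σchains-from≡0 ys r U A A⊈∁U = z≤n
    ... | yes A⊆∁U = begin
      Σchains-from ys r U A * K                                      ≤⟨ *-monoˡ-≤ K (Σchains-from≤Σchains ys r U A) ⟩
      Σchains ys r (U ∪ A) * (N ^ ∣ U ∣ * (N ^ s * (N ^ s) ^ r))     ≡⟨ cong (Σchains ys r (U ∪ A) *_) K≡ ⟩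
      Σchains ys r (U ∪ A) * (N ^ ∣ U ∪ A ∣ * (N ^ s) ^ r)           ≤⟨ Σchains-upper sizes uniq ∣ys∣≡m r (U ∪ A) ⟩
      (N C m) * m ^ ∣ U ∪ A ∣ * D ^ r                                ≡⟨ cong (λ x → (N C m) * m ^ x * D ^ r) ∣U∪A∣≡ ⟩
      B                                                              ∎
      where
      ∣U∪A∣≡ : ∣ U ∪ A ∣ ≡ ∣ U ∣ + s
      ∣U∪A∣≡ = trans (∣p∪q∣≡∣p∣+∣q∣ U A A⊆∁U) (cong (∣ U ∣ +_) ∣A∣≡s)
      K≡ : N ^ ∣ U ∣ * (N ^ s * (N ^ s) ^ r) ≡ N ^ ∣ U ∪ A ∣ * (N ^ s) ^ r
      K≡ = begin-equality
        N ^ ∣ U ∣ * (N ^ s * (N ^ s) ^ r)   ≡⟨ *-assoc (N ^ ∣ U ∣) (N ^ s) _ ⟨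
        N ^ ∣ U ∣ * N ^ s * (N ^ s) ^ r     ≡⟨ cong (_* (N ^ s) ^ r) (^-distribˡ-+-* N ∣ U ∣ s) ⟨
        N ^ (∣ U ∣ + s) * (N ^ s) ^ r       ≡⟨ cong (λ x → N ^ x * (N ^ s) ^ r) ∣U∪A∣≡ ⟨
        N ^ ∣ U ∪ A ∣ * (N ^ s) ^ r         ∎

-- Counting the exceptional sets

k≤[1+k/s]*s : ∀ k s .{{_ : NonZero s}} → k ≤ suc (k / s) * s
k≤[1+k/s]*s k s = ≤-trans (≤-reflexive (m≡m%n+[m/n]*n k s)) (+-monoˡ-≤ (k / s * s) (<⇒≤ (m%n<n k s)))

[1+k/s]*s≤k+s : ∀ k s .{{_ : NonZero s}} → suc (k / s) * s ≤ k + s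
[1+k/s]*s≤k+s k s = ≤-trans (+-monoʳ-≤ s (m/n*n≤m k s)) (≤-reflexive (+-comm s k))

length*T^r≤nCm : ∀ {N s m k} (𝒮 : List (Subset N)) → All (λ A → ∣ A ∣ ≡ s) 𝒮 →
                 .{{_ : NonZero (length 𝒮)}} → .{{_ : NonZero m}} → ∀ {T} → 0ℚ Q.≤ T → ∀ r → r * s ≤ k + s →
                 ∀ {bad} → Unique bad → All (λ Y → ∣ Y ∣ ≡ m) bad →
                 All (λ Y → ∀ U → U ⊆ Y → ∣ U ∣ ≤ k →
                            T Q.* ℕ→ℚ (length 𝒮 * m ^ s) Q.≤ ℕ→ℚ (countInside 𝒮 (Y ─ U) * N ^ s)) bad →
                 ℕ→ℚ (length bad) Q.* T ^ℚ r Q.≤ ℕ→ℚ (N C m)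
length*T^r≤nCm {N} {s} {m} {k} 𝒮 sizes {T} 0≤T r rs≤k+s {bad} uniq ∣bad∣≡m dense =
  ℚₚ.*-cancelʳ-≤-pos (ℕ→ℚ Z) {{ℕ→ℚ-pos Z}} (begin
    ℕ→ℚ (length bad) Q.* T ^ℚ r Q.* ℕ→ℚ Z                 ≡⟨ ℚₚ.*-assoc (ℕ→ℚ (length bad)) (T ^ℚ r) (ℕ→ℚ Z) ⟩
    ℕ→ℚ (length bad) Q.* (T ^ℚ r Q.* ℕ→ℚ Z)               ≡⟨ cong (ℕ→ℚ (length bad) Q.*_) τ^r≡ ⟨
    ℕ→ℚ (length bad) Q.* τ ^ℚ r                           ≤⟨ length*≤sum-map* (λ Y → chains 𝒮 r Y ⊥) (All.map lower dense) ⟩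
    ℕ→ℚ (sum (map (λ Y → chains 𝒮 r Y ⊥) bad) * (N ^ s) ^ r)   ≡⟨ cong ℕ→ℚ Σchains≡ ⟨
    ℕ→ℚ (Σchains 𝒮 bad r ⊥ * (N ^ ∣ ⊥ {N} ∣ * (N ^ s) ^ r))     ≤⟨ ℕ→ℚ-mono-≤ (Σchains-upper 𝒮 sizes uniq ∣bad∣≡m r ⊥) ⟩
    ℕ→ℚ ((N C m) * m ^ ∣ ⊥ {N} ∣ * Z)                     ≡⟨ cong (λ x → ℕ→ℚ ((N C m) * m ^ x * Z)) (∣⊥∣≡0 N) ⟩
    ℕ→ℚ ((N C m) * 1 * Z)                                 ≡⟨ cong (λ x → ℕ→ℚ (x * Z)) (*-identityʳ (N C m)) ⟩
    ℕ→ℚ ((N C m) * Z)                                     ≡⟨ ℕ→ℚ-* (N C m) Z ⟩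
    ℕ→ℚ (N C m) Q.* ℕ→ℚ Z                                 ∎)
  where
  open ℚₚ.≤-Reasoning
  instance
    _ = m^n≢0 m s
    _ = m*n≢0 (length 𝒮) (m ^ s)
    _ = m^n≢0 (length 𝒮 * m ^ s) r
  Z = (length 𝒮 * m ^ s) ^ r
  τ = T Q.* ℕ→ℚ (length 𝒮 * m ^ s)
  τ^r≡ : τ ^ℚ r ≡ T ^ℚ r Q.* ℕ→ℚ Z
  τ^r≡ = trans (^ℚ-distrib-* T _ r) (cong (T ^ℚ r Q.*_) (sym (ℕ→ℚ-^ (length 𝒮 * m ^ s) r)))
  lower : ∀ {Y} → (∀ U → U ⊆ Y → ∣ U ∣ ≤ k → τ Q.≤ ℕ→ℚ (countInside 𝒮 (Y ─ U) * N ^ s)) →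
          τ ^ℚ r Q.≤ ℕ→ℚ (chains 𝒮 r Y ⊥ * (N ^ s) ^ r)
  lower dense-Y = chains-lower 𝒮 τ (*-nonNeg 0≤T (ℕ→ℚ-nonNeg (length 𝒮 * m ^ s))) sizes dense-Y r ⊥ ⊥⊆
    (subst (λ x → x + r * s ≤ k + s) (sym (∣⊥∣≡0 N)) rs≤k+s)
  Σchains≡ : Σchains 𝒮 bad r ⊥ * (N ^ ∣ ⊥ {N} ∣ * (N ^ s) ^ r) ≡ sum (map (λ Y → chains 𝒮 r Y ⊥) bad) * (N ^ s) ^ r
  Σchains≡ = trans
    (cong₂ (λ ys x → sum (map (λ Y → chains 𝒮 r Y ⊥) ys) * (N ^ x * (N ^ s) ^ r))
           (filter-all (⊥ ⊆?_) (All.universal (λ _ {x} → ⊥⊆ {x = x}) bad)) (∣⊥∣≡0 N))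
    (cong (sum (map (λ Y → chains 𝒮 r Y ⊥) bad) *_) (*-identityˡ ((N ^ s) ^ r)))

0<countInside⇒ : ∀ {N s} {Z : Subset N} (𝒮 : List (Subset N)) → All (λ A → ∣ A ∣ ≡ s) 𝒮 →
                 0 < countInside 𝒮 Z → 0 < length 𝒮 × s ≤ ∣ Z ∣
0<countInside⇒ {Z = Z} (A ∷ 𝒮) (∣A∣≡s ∷ sizes) pos with A ⊆? Z
... | yes A⊆Z = s≤s z≤n , subst (_≤ ∣ Z ∣) ∣A∣≡s (p⊆q⇒∣p∣≤∣q∣ A⊆Z)
... | no  _   = s≤s z≤n , proj₂ (0<countInside⇒ 𝒮 sizes pos)

-- τ₀ is the bound 2ˢ T |𝒮| (m/N)ˢ of the statement multiplied by Nˢ, and the exceptional sets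
-- Y are those that are not Good.
module Threshold {N : ℕ} (s k m : ℕ) (𝒮 : List (Subset N)) (T : ℚ) where

  τ₀ : ℚ
  τ₀ = ℕ→ℚ (2 ^ s) Q.* T Q.* ℕ→ℚ (length 𝒮) Q.* (ℕ→ℚ m ^ℚ s)

  Good : Subset N → Set
  Good Y = ∃ λ X → (X ⊆ Y) × (∣ X ∣ ≤ k) × (ℕ→ℚ (countInside 𝒮 (Y ─ X)) Q.* (ℕ→ℚ N ^ℚ s) Q.≤ τ₀)

  T*ℕ→ℚ[L*m^s]≤τ₀ : 0ℚ Q.≤ T → T Q.* ℕ→ℚ (length 𝒮 * m ^ s) Q.≤ τ₀
  T*ℕ→ℚ[L*m^s]≤τ₀ 0≤T = begin
    τ                                                       ≡⟨ ℚₚ.*-identityˡ τ ⟨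
    1ℚ Q.* τ                                                ≤⟨ *-monoʳ-≤-0≤ (*-nonNeg 0≤T (ℕ→ℚ-nonNeg (length 𝒮 * m ^ s)))
                                                                             (ℕ→ℚ-mono-≤ {1} {2 ^ s} (m^n>0 2 s)) ⟩
    ℕ→ℚ (2 ^ s) Q.* τ                                       ≡⟨ cong (λ x → ℕ→ℚ (2 ^ s) Q.* (T Q.* x)) L*m^s≡ ⟩
    ℕ→ℚ (2 ^ s) Q.* (T Q.* (ℕ→ℚ (length 𝒮) Q.* ℕ→ℚ m ^ℚ s)) ≡⟨ ℚₚ.*-assoc (ℕ→ℚ (2 ^ s)) T _ ⟨
    ℕ→ℚ (2 ^ s) Q.* T Q.* (ℕ→ℚ (length 𝒮) Q.* ℕ→ℚ m ^ℚ s)   ≡⟨ ℚₚ.*-assoc (ℕ→ℚ (2 ^ s) Q.* T) _ _ ⟨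
    τ₀                                                      ∎
    where
    open ℚₚ.≤-Reasoning
    τ = T Q.* ℕ→ℚ (length 𝒮 * m ^ s)
    L*m^s≡ : ℕ→ℚ (length 𝒮 * m ^ s) ≡ ℕ→ℚ (length 𝒮) Q.* ℕ→ℚ m ^ℚ s
    L*m^s≡ = trans (ℕ→ℚ-* (length 𝒮) (m ^ s)) (cong (ℕ→ℚ (length 𝒮) Q.*_) (ℕ→ℚ-^ m s))

  ¬Good⇒τ₀<count : ∀ {Y} → ¬ Good Y → ∀ U → U ⊆ Y → ∣ U ∣ ≤ k → τ₀ Q.< ℕ→ℚ (countInside 𝒮 (Y ─ U) * N ^ s)
  ¬Good⇒τ₀<count {Y} ¬good U U⊆Y ∣U∣≤k =
    subst (τ₀ Q.<_) (sym (trans (ℕ→ℚ-* c (N ^ s)) (cong (ℕ→ℚ c Q.*_) (ℕ→ℚ-^ N s))))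
          (ℚₚ.≰⇒> (λ c*N^s≤τ₀ → ¬good (U , U⊆Y , ∣U∣≤k , c*N^s≤τ₀)))
    where c = countInside 𝒮 (Y ─ U)

  ¬Good⇒dense : 0ℚ Q.≤ T → ∀ {Y} → ¬ Good Y → ∀ U → U ⊆ Y → ∣ U ∣ ≤ k →
                T Q.* ℕ→ℚ (length 𝒮 * m ^ s) Q.≤ ℕ→ℚ (countInside 𝒮 (Y ─ U) * N ^ s)
  ¬Good⇒dense 0≤T ¬good U U⊆Y ∣U∣≤k =
    ℚₚ.≤-trans (T*ℕ→ℚ[L*m^s]≤τ₀ 0≤T) (ℚₚ.<⇒≤ (¬Good⇒τ₀<count ¬good U U⊆Y ∣U∣≤k))

  ¬Good⇒nonZero : 0ℚ Q.≤ T → 1 ≤ s → All (λ A → ∣ A ∣ ≡ s) 𝒮 → ∀ {Y} → ∣ Y ∣ ≡ m → ¬ Good Y →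
                  NonZero (length 𝒮) × NonZero m
  ¬Good⇒nonZero 0≤T 1≤s sizes {Y} ∣Y∣≡m ¬good =
    >-nonZero 0<L , >-nonZero (≤-trans 1≤s (≤-trans s≤∣Y─⊥∣ (subst (∣ Y ─ ⊥ ∣ ≤_) ∣Y∣≡m (∣p─q∣≤∣p∣ Y ⊥))))
    where
    0≤τ₀ = ℚₚ.≤-trans (*-nonNeg 0≤T (ℕ→ℚ-nonNeg (length 𝒮 * m ^ s))) (T*ℕ→ℚ[L*m^s]≤τ₀ 0≤T)
    τ₀<count = ¬Good⇒τ₀<count ¬good ⊥ ⊥⊆ (subst (_≤ k) (sym (∣⊥∣≡0 N)) z≤n)
    count≢0 : countInside 𝒮 (Y ─ ⊥) ≢ 0
    count≢0 count≡0 = ℚₚ.<-irrefl refl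
      (ℚₚ.≤-<-trans 0≤τ₀ (subst (λ c → τ₀ Q.< ℕ→ℚ (c * N ^ s)) count≡0 τ₀<count))
    0<L×s≤∣Y─⊥∣ = 0<countInside⇒ 𝒮 sizes (n≢0⇒n>0 count≢0)
    0<L = proj₁ 0<L×s≤∣Y─⊥∣
    s≤∣Y─⊥∣ = proj₂ 0<L×s≤∣Y─⊥∣

lemmaA1 : (N s : ℕ) → 1 ≤ s → (𝒮 : List (Subset N)) → Unique 𝒮 → All (λ A → ∣ A ∣ ≡ s) 𝒮
          → (k : ℕ) → 4 * k < N → (T : ℚ) → T > 1ℚ → (m : ℕ)
          → (bad : List (Subset N)) → Unique bad
          → All (λ Ym → (∣ Ym ∣ ≡ m) × ¬ (∃ λ X → (X ⊆ Ym) × (∣ X ∣ ≤ k) × (ℕ→ℚ (countInside 𝒮 (Ym ─ X)) Q.* (ℕ→ℚ N ^ℚ s) Q.≤ ℕ→ℚ (2 ^ s) Q.* T Q.* ℕ→ℚ (length 𝒮) Q.* (ℕ→ℚ m ^ℚ s)))) bad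
          → (ℕ→ℚ (length bad) ^ℚ s) Q.* (T ^ℚ k) Q.≤ ℕ→ℚ (N C m) ^ℚ s
lemmaA1 N (suc s-1) _ 𝒮 _ sizes k _ T T>1 m [] _ _ = ℚₚ.≤-trans
  (ℚₚ.≤-reflexive (trans (cong (Q._* T ^ℚ k) (ℚₚ.*-zeroˡ (0ℚ ^ℚ s-1))) (ℚₚ.*-zeroˡ (T ^ℚ k))))
  (^ℚ-nonNeg (suc s-1) (ℕ→ℚ-nonNeg (N C m)))
lemmaA1 N s@(suc _) 1≤s 𝒮 _ sizes k _ T T>1 m bad@(_ ∷ _) uniq isBad = begin
  ℕ→ℚ (length bad) ^ℚ s Q.* T ^ℚ k          ≤⟨ *-monoˡ-≤-0≤ (^ℚ-nonNeg s (ℕ→ℚ-nonNeg (length bad)))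
                                                               (^ℚ-monoʳ-≤ 1≤T (≤⇒≤′ (k≤[1+k/s]*s k s))) ⟩
  ℕ→ℚ (length bad) ^ℚ s Q.* T ^ℚ (r * s)    ≡⟨ cong (ℕ→ℚ (length bad) ^ℚ s Q.*_) (^ℚ-*-assoc T r s) ⟨
  ℕ→ℚ (length bad) ^ℚ s Q.* (T ^ℚ r) ^ℚ s   ≡⟨ ^ℚ-distrib-* (ℕ→ℚ (length bad)) (T ^ℚ r) s ⟨
  (ℕ→ℚ (length bad) Q.* T ^ℚ r) ^ℚ s        ≤⟨ ^ℚ-monoˡ-≤ s (*-nonNeg (ℕ→ℚ-nonNeg (length bad)) (^ℚ-nonNeg r 0≤T)) bad-bound ⟩
  ℕ→ℚ (N C m) ^ℚ s                          ∎
  where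
  open ℚₚ.≤-Reasoning
  open Threshold s k m 𝒮 T
  1≤T = ℚₚ.<⇒≤ T>1
  0≤T = ℚₚ.≤-trans (ℕ→ℚ-nonNeg 1) 1≤T
  r = suc (k / s)
  nonZero = ¬Good⇒nonZero 0≤T 1≤s sizes (proj₁ (All.head isBad)) (proj₂ (All.head isBad))
  bad-bound : ℕ→ℚ (length bad) Q.* T ^ℚ r Q.≤ ℕ→ℚ (N C m)
  bad-bound = length*T^r≤nCm 𝒮 sizes {{proj₁ nonZero}} {{proj₂ nonZero}} 0≤T r ([1+k/s]*s≤k+s k s) uniq
                (All.map proj₁ isBad) (All.map (¬Good⇒dense 0≤T ∘ proj₂) isBad)
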